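{- Let $\mathcal{L}=(S,\iota,\rightarrow)$ be an LTS and let $\mathsf{norm}_{\mathsf{fdr}}(\mathcal{L})=(S',\iota',\rightarrow')$ be its failures-divergences normal form. For all sequences $\rho\in\mathit{Act}^*$: $\rho\notin\mathsf{divergences}(\mathcal{L})\cup\mathsf{weaktraces}(\mathcal{L})$ if and only if $\iota'\overset{\rho}{\twoheadrightarrow}{}'\emptyset$.
   Context: Fix a finite set $\mathit{Act}$ of actions not containing the internal action $\tau$; $\mathit{Act}_\tau=\mathit{Act}\cup\{\tau\}$. An LTS is $(S,\iota,\rightarrow)$ with $\iota\in S$ and $\rightarrow\subseteq S\times\mathit{Act}_\tau\times S$. For $\sigma\in\mathit{Act}_\tau^*$, $s\overset{\sigma}{\twoheadrightarrow}t$ means there is a path from $s$ to $t$ whose labels, in order, form exactly $\sigma$ (with $s\overset{\epsilon}{\twoheadrightarrow}t$ iff $s=t$). The weak transition relation $\Longrightarrow\subseteq S\times\mathit{Act}^*\times S$ is the smallest relation with $s\overset{\epsilon}{\Longrightarrow}s$; $s\overset{\epsilon}{\Longrightarrow}t$ if $s\xrightarrow{\tau}t$; $s\overset{a}{\Longrightarrow}t$ if $s\xrightarrow{a}t$ ($a\in\mathit{Act}$); $s\overset{\rho\sigma}{\Longrightarrow}t$ if $s\overset{\rho}{\Longrightarrow}u\overset{\sigma}{\Longrightarrow}t$. $\mathsf{weaktraces}(\mathcal{L})=\{\rho\in\mathit{Act}^*\mid\exists t: \iota\overset{\rho}{\Longrightarrow}t\}$. A state $s$ diverges if there is an infinite sequence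 $s\xrightarrow{\tau}s_1\xrightarrow{\tau}s_2\xrightarrow{\tau}\cdots$. $\mathsf{divergences}(\mathcal{L})=\{\rho\sigma\in\mathit{Act}^*\mid \exists t: \iota\overset{\rho}{\Longrightarrow}t \text{ and } t \text{ diverges}\}$. The failures-divergences normal form $\mathsf{norm}_{\mathsf{fdr}}(\mathcal{L})=(S',\iota',\rightarrow')$ has $S'=\mathcal{P}(S)$, $\iota'=\{s\in S\mid \iota\overset{\epsilon}{\Longrightarrow}s\}$, and for all $U,V\subseteq S$ and $a\in\mathit{Act}$: $U\xrightarrow{a}{}'V$ iff no state of $U$ diverges and $V=\{t\in S\mid \exists s\in U: s\overset{a}{\Longrightarrow}t\}$. -}

module Defs where

open import Data.Nat using (ℕ; zero; suc)
open import Data.Fin using (Fin)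
open import Data.List using (List; []; _∷_; _++_)
open import Data.Product using (Σ; ∃; _×_; _,_)
open import Data.Empty using (⊥)
open import Relation.Nullary using (¬_)
open import Relation.Binary.PropositionalEquality using (_≡_)
open import Level using (Level; _⊔_)

data Label (n : ℕ) : Set where
  τ   : Label n
  act : Fin n → Label n

record LTS (n : ℕ) : Set₁ where
  field
    S     : Set
    ι     : S
    _⟶⟨_⟩_ : S → Label n → S → Set

Subset : Set → Set₁
Subset X = X → Set

∅ : {X : Set} → Subset X
∅ _ = ⊥

data Path {ℓ r : Level} {n : ℕ} {X : Set ℓ} (R : X → Fin n → X → Set r)
          : X → List (Fin n) → X → Set (ℓ ⊔ r) where
  done : ∀ {x} → Path R x [] x
  step : ∀ {x y z a ρ} → R x a y → Path R y ρ z → Path R x (a ∷ ρ) z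

module _ {n : ℕ} (L : LTS n) where
  open LTS L

  data _⟹⟨_⟩_ : S → List (Fin n) → S → Set where
    w-refl : ∀ {s} → s ⟹⟨ [] ⟩ s
    w-τ    : ∀ {s t} → s ⟶⟨ τ ⟩ t → s ⟹⟨ [] ⟩ t
    w-act  : ∀ {s t a} → s ⟶⟨ act a ⟩ t → s ⟹⟨ a ∷ [] ⟩ t
    w-seq  : ∀ {s u t ρ σ} → s ⟹⟨ ρ ⟩ u → u ⟹⟨ σ ⟩ t → s ⟹⟨ ρ ++ σ ⟩ t

  weaktraces : List (Fin n) → Set
  weaktraces ρ = ∃ λ t → ι ⟹⟨ ρ ⟩ t

  Diverges : S → Set
  Diverges s = Σ (ℕ → S) λ f → (f zero ≡ s) × (∀ i → f i ⟶⟨ τ ⟩ f (suc i))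

  divergences : List (Fin n) → Set
  divergences π = Σ (List (Fin n)) λ ρ → Σ (List (Fin n)) λ σ →
    (π ≡ ρ ++ σ) × (∃ λ t → (ι ⟹⟨ ρ ⟩ t) × Diverges t)

  -- Failures-divergences normal form: states are subsets of S.
  ι′ : Subset S
  ι′ s = ι ⟹⟨ [] ⟩ s

  -- U -a->' V iff no state of U diverges and V = {t | ∃ s ∈ U. s ⟹a t}
  -- (set equality of subsets = extensional equality).
  _⟶′⟨_⟩_ : Subset S → Fin n → Subset S → Set
  U ⟶′⟨ a ⟩ V =
    (∀ s → U s → ¬ Diverges s) ×
    (∀ t → (V t → ∃ λ s → U s × (s ⟹⟨ a ∷ [] ⟩ t)) ×
           ((∃ λ s → U s × (s ⟹⟨ a ∷ [] ⟩ t)) → V t))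

  _↠′⟨_⟩_ : Subset S → List (Fin n) → Subset S → Set₁
  U ↠′⟨ ρ ⟩ V = Path _⟶′⟨_⟩_ U ρ V

module Submission where

-- The proof works relative to an arbitrary set U of states.  Reach U ρ is
-- the set of states weakly reachable from U along ρ, and Fails U ρ says
-- that ρ is neither a weak trace nor a divergence "from U".  Two unfolding
-- laws describe Fails by recursion on ρ:
--   Fails U []      ⇔  U is empty,
--   Fails U (a ∷ ρ) ⇔  no state of U diverges  ×  Fails (Reach U [a]) ρ.
-- The second law is exactly the shape of one step U ⟶′⟨ a ⟩ Reach U [a]
-- of the normal form, so induction on ρ shows Fails U ρ ⇔ U ⇝ ρ ∶ ∅
-- (for ρ = [] only "⇐", as the path to ∅ must then be literally ∅).
-- Finally Fails ι′ ρ is the paper's condition, since Reach ι′ ρ is the set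
-- of states reachable from ι along ρ; the case ρ = [] is absurd on both
-- sides because ι′ contains ι.
--
-- Inverting the weak transition relation ⟹ of Defs is awkward because of
-- its concatenation clause, so we first show it equivalent to an inductive
-- presentation by single steps.

open import Defs
open import Data.Nat using (ℕ; zero; suc)
open import Data.Fin using (Fin)
open import Data.List using (List; []; _∷_; _++_)
open import Data.Product using (Σ; ∃; _×_; _,_; proj₂)
open import Data.Sum using (_⊎_; inj₁; inj₂)
open import Data.Sum.Function.Propositional using (_⊎-⇔_)
open import Data.Empty using (⊥-elim)
open import Relation.Nullary using (¬_)
open import Relation.Unary using (_⊆_; Empty)
open import Relation.Binary.PropositionalEquality using (_≡_; refl; sym; subst)
open import Function using (id)
open import Function.Bundles using (_⇔_; mk⇔; Equivalence)
open import Function.Related.TypeIsomorphisms using (¬-cong-⇔)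
import Function.Properties.Equivalence as ⇔

module NormalForm {n : ℕ} (L : LTS n) where
  open LTS L

  Word : Set
  Word = List (Fin n)

  _⟹_∶_ : S → Word → S → Set
  s ⟹ ρ ∶ t = _⟹⟨_⟩_ L s ρ t

  _⇝_∶_ : Subset S → Word → Subset S → Set₁
  U ⇝ ρ ∶ V = _↠′⟨_⟩_ L U ρ V

  data WeakPath : S → Word → S → Set where
    stop     : ∀ {s} → WeakPath s [] s
    τ-step   : ∀ {s u t ρ} → s ⟶⟨ τ ⟩ u → WeakPath u ρ t → WeakPath s ρ t
    act-step : ∀ {s u t a ρ} →
               s ⟶⟨ act a ⟩ u → WeakPath u ρ t → WeakPath s (a ∷ ρ) t

  weakPath-++ : ∀ {s u t ρ σ} → WeakPath s ρ u → WeakPath u σ t →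
                WeakPath s (ρ ++ σ) t
  weakPath-++ stop           q = q
  weakPath-++ (τ-step x p)   q = τ-step x (weakPath-++ p q)
  weakPath-++ (act-step x p) q = act-step x (weakPath-++ p q)

  weakPath-split : ∀ ρ {σ s t} → WeakPath s (ρ ++ σ) t →
                   ∃ λ u → WeakPath s ρ u × WeakPath u σ t
  weakPath-split []      p              = _ , stop , p
  weakPath-split (a ∷ ρ) (τ-step x p)   with weakPath-split (a ∷ ρ) p
  ... | u , q , r = u , τ-step x q , r
  weakPath-split (a ∷ ρ) (act-step x p) with weakPath-split ρ p
  ... | u , q , r = u , act-step x q , r

  ⟹⇒weakPath : ∀ {s t ρ} → s ⟹ ρ ∶ t → WeakPath s ρ t
  ⟹⇒weakPath w-refl      = stop
  ⟹⇒weakPath (w-τ x)     = τ-step x stop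
  ⟹⇒weakPath (w-act x)   = act-step x stop
  ⟹⇒weakPath (w-seq p q) = weakPath-++ (⟹⇒weakPath p) (⟹⇒weakPath q)

  weakPath⇒⟹ : ∀ {s t ρ} → WeakPath s ρ t → s ⟹ ρ ∶ t
  weakPath⇒⟹ stop           = w-refl
  weakPath⇒⟹ (τ-step x p)   = w-seq (w-τ x) (weakPath⇒⟹ p)
  weakPath⇒⟹ (act-step x p) = w-seq (w-act x) (weakPath⇒⟹ p)

  ⟹-split : ∀ ρ {σ s t} → s ⟹ ρ ++ σ ∶ t → ∃ λ u → s ⟹ ρ ∶ u × u ⟹ σ ∶ t
  ⟹-split ρ w with weakPath-split ρ (⟹⇒weakPath w)
  ... | u , p , q = u , weakPath⇒⟹ p , weakPath⇒⟹ q

  diverges-τ : ∀ {s t} → s ⟶⟨ τ ⟩ t → Diverges L t → Diverges L s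
  diverges-τ {s} x (f , f0≡t , fτ) = g , refl , gτ
    where
    g : ℕ → S
    g zero    = s
    g (suc i) = f i

    gτ : ∀ i → g i ⟶⟨ τ ⟩ g (suc i)
    gτ zero    = subst (s ⟶⟨ τ ⟩_) (sym f0≡t) x
    gτ (suc i) = fτ i

  diverges-silent : ∀ {s t} → s ⟹ [] ∶ t → Diverges L t → Diverges L s
  diverges-silent w = go (⟹⇒weakPath w)
    where
    go : ∀ {s t} → WeakPath s [] t → Diverges L t → Diverges L s
    go stop         d = d
    go (τ-step x p) d = diverges-τ x (go p d)

  Reach : Subset S → Word → Subset S
  Reach U ρ t = ∃ λ s → U s × s ⟹ ρ ∶ t

  reach-refl : ∀ {U} → U ⊆ Reach U []
  reach-refl u = _ , u , w-refl

  reach-mono : ∀ {U V} ρ → U ⊆ V → Reach U ρ ⊆ Reach V ρ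
  reach-mono ρ U⊆V (s , u , w) = s , U⊆V u , w

  reach-join : ∀ {U} ρ σ → Reach (Reach U ρ) σ ⊆ Reach U (ρ ++ σ)
  reach-join ρ σ (u , (s , us , w) , w′) = s , us , w-seq w w′

  reach-split : ∀ {U} ρ σ → Reach U (ρ ++ σ) ⊆ Reach (Reach U ρ) σ
  reach-split ρ σ (s , us , w) with ⟹-split ρ w
  ... | u , w₁ , w₂ = u , (s , us , w₁) , w₂

  Diverging : Subset S → Set
  Diverging U = ∃ λ s → U s × Diverges L s

  Convergent : Subset S → Set
  Convergent U = ∀ s → U s → ¬ Diverges L s

  TracesFrom : Subset S → Word → Set
  TracesFrom U ρ = ∃ (Reach U ρ)

  DivergesFrom : Subset S → Word → Set
  DivergesFrom U π = Σ Word λ ρ → Σ Word λ σ → (π ≡ ρ ++ σ) × Diverging (Reach U ρ)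

  Fails : Subset S → Word → Set
  Fails U ρ = ¬ (DivergesFrom U ρ ⊎ TracesFrom U ρ)

  fails-antitone : ∀ {U V} ρ → U ⊆ V → Fails V ρ → Fails U ρ
  fails-antitone ρ U⊆V fails (inj₁ (ρ₁ , σ , eq , t , r , d)) =
    fails (inj₁ (ρ₁ , σ , eq , t , reach-mono ρ₁ U⊆V r , d))
  fails-antitone ρ U⊆V fails (inj₂ (t , r)) = fails (inj₂ (t , reach-mono ρ U⊆V r))

  fails-[] : ∀ {U} → Fails U [] ⇔ Empty U
  fails-[] {U} = mk⇔ (λ fails s u → fails (inj₂ (s , reach-refl u))) from
    where
    from : Empty U → Fails U []
    from empty (inj₁ (_ , _ , _ , _ , (s , u , _) , _)) = empty s u
    from empty (inj₂ (_ , s , u , _))                   = empty s u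

  fails-∷ : ∀ {U} a ρ →
            Fails U (a ∷ ρ) ⇔ (Convergent U × Fails (Reach U (a ∷ [])) ρ)
  fails-∷ {U} a ρ = mk⇔ to from
    where
    to : Fails U (a ∷ ρ) → Convergent U × Fails (Reach U (a ∷ [])) ρ
    to fails = (λ s u d → fails (inj₁ ([] , a ∷ ρ , refl , s , reach-refl u , d)))
             , λ { (inj₁ (ρ₁ , σ , refl , t , r , d)) →
                     fails (inj₁ (a ∷ ρ₁ , σ , refl , t , reach-join (a ∷ []) ρ₁ r , d))
                 ; (inj₂ (t , r)) → fails (inj₂ (t , reach-join (a ∷ []) ρ r)) }

    from : Convergent U × Fails (Reach U (a ∷ [])) ρ → Fails U (a ∷ ρ)
    from (convergent , _) (inj₁ ([] , _ , _ , t , (s , u , w) , d)) =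
      convergent s u (diverges-silent w d)
    from (_ , fails) (inj₁ (_ ∷ ρ₁ , σ , refl , t , r , d)) =
      fails (inj₁ (ρ₁ , σ , refl , t , reach-split (a ∷ []) ρ₁ r , d))
    from (_ , fails) (inj₂ (t , r)) = fails (inj₂ (t , reach-split (a ∷ []) ρ r))

  path-fails : ∀ {U} ρ → U ⇝ ρ ∶ ∅ → Fails U ρ
  path-fails []      done = Equivalence.from fails-[] (λ _ ())
  path-fails (a ∷ ρ) (step (convergent , V≐next) p) =
    Equivalence.from (fails-∷ a ρ)
      (convergent , fails-antitone ρ (λ {t} → proj₂ (V≐next t)) (path-fails ρ p))

  -- Conversely, a non-empty failing word is a path into ∅: each step goes to
  -- the set of a-successors, except the last, which goes to ∅ directly.
  fails-path : ∀ {U} a ρ → Fails U (a ∷ ρ) → U ⇝ a ∷ ρ ∶ ∅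
  fails-path a [] fails with Equivalence.to (fails-∷ a []) fails
  ... | convergent , rest =
    step (convergent , λ t → (λ ()) , Equivalence.to fails-[] rest t) done
  fails-path a (b ∷ ρ) fails with Equivalence.to (fails-∷ a (b ∷ ρ)) fails
  ... | convergent , rest = step (convergent , λ t → id , id) (fails-path b ρ rest)

  reach-ι′ : ∀ ρ {t} → Reach (ι′ L) ρ t ⇔ ι ⟹ ρ ∶ t
  reach-ι′ ρ = mk⇔ (λ { (s , ι⟹s , w) → w-seq ι⟹s w }) (λ w → ι , w-refl , w)

  fails-ι′ : ∀ ρ → Fails (ι′ L) ρ ⇔ (¬ (divergences L ρ ⊎ weaktraces L ρ))
  fails-ι′ ρ = ¬-cong-⇔ (divergences-ι′ ⊎-⇔ traces-ι′)
    where
    divergences-ι′ : DivergesFrom (ι′ L) ρ ⇔ divergences L ρ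
    divergences-ι′ = mk⇔
      (λ { (ρ₁ , σ , eq , t , r , d) → ρ₁ , σ , eq , t , Equivalence.to (reach-ι′ ρ₁) r , d })
      (λ { (ρ₁ , σ , eq , t , w , d) → ρ₁ , σ , eq , t , Equivalence.from (reach-ι′ ρ₁) w , d })

    traces-ι′ : TracesFrom (ι′ L) ρ ⇔ weaktraces L ρ
    traces-ι′ = mk⇔ (λ { (t , r) → t , Equivalence.to (reach-ι′ ρ) r })
                    (λ { (t , w) → t , Equivalence.from (reach-ι′ ρ) w })

  -- The empty word never fails from ι′, as ι′ contains ι.
  fails⇔path : ∀ ρ → Fails (ι′ L) ρ ⇔ ι′ L ⇝ ρ ∶ ∅
  fails⇔path []      = mk⇔ (λ fails → ⊥-elim (Equivalence.to fails-[] fails ι w-refl))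
                           (path-fails [])
  fails⇔path (a ∷ ρ) = mk⇔ (fails-path a ρ) (path-fails (a ∷ ρ))

open NormalForm

lemma3p20 : {n : ℕ} (L : LTS n) (ρ : List (Fin n)) →
    (¬ (divergences L ρ ⊎ weaktraces L ρ)) ⇔ (_↠′⟨_⟩_ L (ι′ L) ρ ∅)
lemma3p20 L ρ = ⇔.trans (⇔.sym (fails-ι′ L ρ)) (fails⇔path L ρ)
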